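{- For all non-negative integers $n$ and $p$ and every real $x$, \[ B_{n,p+1}(x+1)-B_{n,p+1}(x)=\frac{p+2}{p+1}\left(B_{n,p}(x+1)-x^{n}\right). \]
   Context: For each integer $p\geq 0$, the $p$-Bernoulli numbers $B_{n,p}$ are defined by $B_{0,p}=1$ and $B_{n+1,p}=pB_{n,p}-\frac{(p+1)^{2}}{p+2}B_{n,p+1}$ ($n,p\ge 0$), and the $p$-Bernoulli polynomials by $B_{n,p}(x)=\sum_{k=0}^{n}\binom{n}{k}x^{n-k}B_{k,p}$. The convention $x^0=1$ (including $0^0=1$) is used.
   Formalization: The variable x ranges over the rationals instead of the reals. -}

module Defs where

open import Data.Nat as ℕ using (ℕ; zero; suc)
open import Data.Nat.Combinatorics using (_C_)
open import Data.Integer using (+_)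
open import Data.Rational using (ℚ; _+_; _*_; _-_; _/_; 0ℚ; 1ℚ)

_^ℚ_ : ℚ → ℕ → ℚ
x ^ℚ zero  = 1ℚ
x ^ℚ suc n = x * (x ^ℚ n)

ℕ→ℚ : ℕ → ℚ
ℕ→ℚ m = + m / 1

B : ℕ → ℕ → ℚ
B zero    p = 1ℚ
B (suc n) p = ℕ→ℚ p * B n p - ((+ (suc p ℕ.* suc p)) / suc (suc p)) * B n (suc p)

Σ≤ : ℕ → (ℕ → ℚ) → ℚ
Σ≤ zero    f = f 0
Σ≤ (suc m) f = Σ≤ m f + f (suc m)

Bpoly : ℕ → ℕ → ℚ → ℚ
Bpoly n p x = Σ≤ n (λ k → ℕ→ℚ (n C k) * (x ^ℚ (n ℕ.∸ k)) * B k p)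

{-# OPTIONS --safe #-}
-- Splitting C(n+1,k) by Pascal's rule and feeding the defining recurrence of B_{k,p} into
-- the sum gives B_{n+1,p}(x) = (x+p) B_{n,p}(x) - (p+1)²/(p+2) B_{n,p+1}(x).  Substituting
-- this on both sides, the identity for n+1 follows from the identities for n at p and at
-- p+1; the rational constants collapse because (p+2)/(p+1) · (p+1) = p+2 and
-- (p+1)²/(p+2) · (p+2)/(p+1) = p+1.
module Submission where

open import Defs
open import Data.Nat using (ℕ; suc)
open import Data.Integer using (+_)
open import Data.Rational using (ℚ; _+_; _*_; _-_; _/_; 1ℚ)
open import Relation.Binary.PropositionalEquality using (_≡_)

open import Algebra.Bundles using (module CommutativeRing)
open import Data.List.Base using (_∷_; [])
open import Data.Nat as ℕ using (zero; _<_; s≤s)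
import Data.Nat.Properties as ℕ
open import Data.Nat.Combinatorics using (_C_; nCk+nC[k+1]≡[n+1]C[k+1]; k>n⇒nCk≡0)
import Data.Integer as ℤ
import Data.Integer.Properties as ℤ
open import Data.Rational using (0ℚ; -_; toℚᵘ; fromℚᵘ)
open import Data.Rational.Properties
  using ( _≟_; +-*-commutativeRing; toℚᵘ-injective; toℚᵘ-fromℚᵘ; fromℚᵘ-cong
        ; toℚᵘ-homo-+; toℚᵘ-homo-*; +-assoc; +-comm; *-assoc; +-identityʳ
        ; *-zeroˡ; *-zeroʳ; *-distribˡ-+; *-distribʳ-+; neg-distribˡ-*)
open import Data.Rational.Unnormalised as ℚᵘ using (mkℚᵘ; *≡*)
import Data.Rational.Unnormalised.Properties as ℚᵘ
open import Function.Base using (_∘_)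
open import Level using (0ℓ)
open import Relation.Binary.PropositionalEquality
  using (refl; sym; trans; cong; cong₂; module ≡-Reasoning)
open import Relation.Nullary.Decidable using (yes; no; dec⇒maybe)
open import Tactic.RingSolver using (solve-∀; solve)
import Tactic.RingSolver.Core.AlmostCommutativeRing as ACR

open import Algebra.Properties.CommutativeSemigroup
  (CommutativeRing.*-commutativeSemigroup +-*-commutativeRing) using (x∙yz≈y∙xz)

ℚ-ring : ACR.AlmostCommutativeRing 0ℓ 0ℓ
ℚ-ring = ACR.fromCommutativeRing +-*-commutativeRing (λ q → dec⇒maybe (0ℚ ≟ q))

fromℚᵘ-homo-+ : ∀ p q → fromℚᵘ (p ℚᵘ.+ q) ≡ fromℚᵘ p + fromℚᵘ q
fromℚᵘ-homo-+ p q = toℚᵘ-injective (begin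
  toℚᵘ (fromℚᵘ (p ℚᵘ.+ q))                ≈⟨ toℚᵘ-fromℚᵘ (p ℚᵘ.+ q) ⟩
  p ℚᵘ.+ q                                ≈⟨ ℚᵘ.+-cong (toℚᵘ-fromℚᵘ p) (toℚᵘ-fromℚᵘ q) ⟨
  toℚᵘ (fromℚᵘ p) ℚᵘ.+ toℚᵘ (fromℚᵘ q)    ≈⟨ toℚᵘ-homo-+ (fromℚᵘ p) (fromℚᵘ q) ⟨
  toℚᵘ (fromℚᵘ p + fromℚᵘ q)              ∎)
  where open ℚᵘ.≃-Reasoning

fromℚᵘ-homo-* : ∀ p q → fromℚᵘ (p ℚᵘ.* q) ≡ fromℚᵘ p * fromℚᵘ q
fromℚᵘ-homo-* p q = toℚᵘ-injective (begin
  toℚᵘ (fromℚᵘ (p ℚᵘ.* q))                ≈⟨ toℚᵘ-fromℚᵘ (p ℚᵘ.* q) ⟩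
  p ℚᵘ.* q                                ≈⟨ ℚᵘ.*-cong (toℚᵘ-fromℚᵘ p) (toℚᵘ-fromℚᵘ q) ⟨
  toℚᵘ (fromℚᵘ p) ℚᵘ.* toℚᵘ (fromℚᵘ q)    ≈⟨ toℚᵘ-homo-* (fromℚᵘ p) (fromℚᵘ q) ⟨
  toℚᵘ (fromℚᵘ p * fromℚᵘ q)              ∎)
  where open ℚᵘ.≃-Reasoning

ℕ→ℚ-+ : ∀ m n → ℕ→ℚ (m ℕ.+ n) ≡ ℕ→ℚ m + ℕ→ℚ n
ℕ→ℚ-+ m n = trans (fromℚᵘ-cong m+n≃m+n) (fromℚᵘ-homo-+ (mkℚᵘ (+ m) 0) (mkℚᵘ (+ n) 0))
  where
  m+n≃m+n : mkℚᵘ (+ (m ℕ.+ n)) 0 ℚᵘ.≃ mkℚᵘ (+ m) 0 ℚᵘ.+ mkℚᵘ (+ n) 0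
  m+n≃m+n = *≡* (cong (ℤ._* + 1) (sym (cong₂ ℤ._+_ (ℤ.*-identityʳ (+ m)) (ℤ.*-identityʳ (+ n)))))

ℕ→ℚ-suc : ∀ n → ℕ→ℚ (suc n) ≡ 1ℚ + ℕ→ℚ n
ℕ→ℚ-suc = ℕ→ℚ-+ 1

fraction-*-fraction : ∀ a b c d e → a ℕ.* c ≡ e ℕ.* (suc b ℕ.* suc d) →
                      (+ a / suc b) * (+ c / suc d) ≡ ℕ→ℚ e
fraction-*-fraction a b c d e ac≡e[bd] =
  trans (sym (fromℚᵘ-homo-* (mkℚᵘ (+ a) b) (mkℚᵘ (+ c) d))) (fromℚᵘ-cong ac/bd≃e)
  where
  open ≡-Reasoning
  ac/bd≃e : mkℚᵘ (+ a) b ℚᵘ.* mkℚᵘ (+ c) d ℚᵘ.≃ mkℚᵘ (+ e) 0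
  ac/bd≃e = *≡* (begin
    (+ a ℤ.* + c) ℤ.* + 1          ≡⟨ ℤ.*-identityʳ (+ a ℤ.* + c) ⟩
    + a ℤ.* + c                    ≡⟨ ℤ.pos-* a c ⟨
    + (a ℕ.* c)                    ≡⟨ cong +_ ac≡e[bd] ⟩
    + (e ℕ.* (suc b ℕ.* suc d))    ≡⟨ ℤ.pos-* e (suc b ℕ.* suc d) ⟩
    + e ℤ.* + (suc b ℕ.* suc d)    ∎)

ρ : ℕ → ℚ
ρ p = (+ suc (suc p)) / suc p

κ : ℕ → ℚ
κ p = (+ (suc p ℕ.* suc p)) / suc (suc p)

ρ*[1+p]≡2+p : ∀ p → ρ p * ℕ→ℚ (suc p) ≡ ℕ→ℚ (suc (suc p))
ρ*[1+p]≡2+p p = fraction-*-fraction (suc (suc p)) p (suc p) 0 (suc (suc p))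
  (cong (suc (suc p) ℕ.*_) (sym (ℕ.*-identityʳ (suc p))))

κ*ρ≡1+p : ∀ p → κ p * ρ p ≡ ℕ→ℚ (suc p)
κ*ρ≡1+p p = fraction-*-fraction (suc p ℕ.* suc p) (suc p) (suc (suc p)) p (suc p)
  (trans (ℕ.*-assoc (suc p) (suc p) (suc (suc p)))
         (cong (suc p ℕ.*_) (ℕ.*-comm (suc p) (suc (suc p)))))

Σ≤-cong : ∀ m {f g : ℕ → ℚ} → (∀ k → f k ≡ g k) → Σ≤ m f ≡ Σ≤ m g
Σ≤-cong zero    f≗g = f≗g 0
Σ≤-cong (suc m) f≗g = cong₂ _+_ (Σ≤-cong m f≗g) (f≗g (suc m))

Σ≤-distrib-+ : ∀ m (f g : ℕ → ℚ) → Σ≤ m (λ k → f k + g k) ≡ Σ≤ m f + Σ≤ m g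
Σ≤-distrib-+ zero    f g = refl
Σ≤-distrib-+ (suc m) f g =
  trans (cong (_+ (f (suc m) + g (suc m))) (Σ≤-distrib-+ m f g))
        (interchange (Σ≤ m f) (Σ≤ m g) (f (suc m)) (g (suc m)))
  where
  interchange : ∀ a b c d → (a + b) + (c + d) ≡ (a + c) + (b + d)
  interchange = solve-∀ ℚ-ring

*-distribˡ-Σ≤ : ∀ m u (f : ℕ → ℚ) → u * Σ≤ m f ≡ Σ≤ m (λ k → u * f k)
*-distribˡ-Σ≤ zero    u f = refl
*-distribˡ-Σ≤ (suc m) u f =
  trans (*-distribˡ-+ u (Σ≤ m f) (f (suc m))) (cong (_+ u * f (suc m)) (*-distribˡ-Σ≤ m u f))

Σ≤-shift : ∀ m (f : ℕ → ℚ) → Σ≤ (suc m) f ≡ f 0 + Σ≤ m (f ∘ suc)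
Σ≤-shift zero    f = refl
Σ≤-shift (suc m) f =
  trans (cong (_+ f (suc (suc m))) (Σ≤-shift m f)) (+-assoc (f 0) (Σ≤ m (f ∘ suc)) (f (suc (suc m))))

Σ≤-shift-vanishing : ∀ m (f : ℕ → ℚ) → f (suc m) ≡ 0ℚ → f 0 + Σ≤ m (f ∘ suc) ≡ Σ≤ m f
Σ≤-shift-vanishing m f f[1+m]≡0 = begin
  f 0 + Σ≤ m (f ∘ suc)  ≡⟨ Σ≤-shift m f ⟨
  Σ≤ m f + f (suc m)    ≡⟨ cong (_+_ (Σ≤ m f)) f[1+m]≡0 ⟩
  Σ≤ m f + 0ℚ           ≡⟨ +-identityʳ (Σ≤ m f) ⟩
  Σ≤ m f                ∎
  where open ≡-Reasoning

^ℚ-∸-suc : ∀ x {n k} → k < n → x ^ℚ (n ℕ.∸ k) ≡ x * x ^ℚ (n ℕ.∸ suc k)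
^ℚ-∸-suc x {suc n} {zero}  _       = refl
^ℚ-∸-suc x {suc n} {suc k} (s≤s k<n) = ^ℚ-∸-suc x k<n

k>n⇒ℕ→ℚ[nCk]≡0 : ∀ {n k} → n < k → ℕ→ℚ (n C k) ≡ 0ℚ
k>n⇒ℕ→ℚ[nCk]≡0 n<k = cong ℕ→ℚ (k>n⇒nCk≡0 n<k)

binomialTerm : ℕ → ℚ → ℕ → ℚ
binomialTerm n x k = ℕ→ℚ (n C k) * x ^ℚ (n ℕ.∸ k)

k>n⇒binomialTerm≡0 : ∀ {n k} x → n < k → binomialTerm n x k ≡ 0ℚ
k>n⇒binomialTerm≡0 {n} {k} x n<k =
  trans (cong (_* x ^ℚ (n ℕ.∸ k)) (k>n⇒ℕ→ℚ[nCk]≡0 n<k)) (*-zeroˡ (x ^ℚ (n ℕ.∸ k)))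

nC[1+k]*x^[n∸k]≡x*binomialTerm : ∀ n k x →
  ℕ→ℚ (n C suc k) * x ^ℚ (n ℕ.∸ k) ≡ x * binomialTerm n x (suc k)
nC[1+k]*x^[n∸k]≡x*binomialTerm n k x with k ℕ.<? n
... | yes k<n = trans (cong (ℕ→ℚ (n C suc k) *_) (^ℚ-∸-suc x k<n))
                      (x∙yz≈y∙xz (ℕ→ℚ (n C suc k)) x (x ^ℚ (n ℕ.∸ suc k)))
... | no  k≮n = begin
  ℕ→ℚ (n C suc k) * x ^ℚ (n ℕ.∸ k)  ≡⟨ cong (_* x ^ℚ (n ℕ.∸ k)) (k>n⇒ℕ→ℚ[nCk]≡0 n<1+k) ⟩
  0ℚ * x ^ℚ (n ℕ.∸ k)               ≡⟨ *-zeroˡ (x ^ℚ (n ℕ.∸ k)) ⟩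
  0ℚ                                ≡⟨ *-zeroʳ x ⟨
  x * 0ℚ                            ≡⟨ cong (x *_) (k>n⇒binomialTerm≡0 x n<1+k) ⟨
  x * binomialTerm n x (suc k)      ∎
  where
  open ≡-Reasoning
  n<1+k : n < suc k
  n<1+k = s≤s (ℕ.≮⇒≥ k≮n)

binomialTerm-suc-zero : ∀ n x → binomialTerm (suc n) x 0 ≡ x * binomialTerm n x 0
binomialTerm-suc-zero n x = x∙yz≈y∙xz 1ℚ x (x ^ℚ n)

binomialTerm-suc-suc : ∀ n x k →
  binomialTerm (suc n) x (suc k) ≡ x * binomialTerm n x (suc k) + binomialTerm n x k
binomialTerm-suc-suc n x k = begin
  ℕ→ℚ (suc n C suc k) * x ^ℚ (n ℕ.∸ k)
    ≡⟨ cong (λ c → ℕ→ℚ c * x ^ℚ (n ℕ.∸ k)) (nCk+nC[k+1]≡[n+1]C[k+1] n k) ⟨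
  ℕ→ℚ (n C k ℕ.+ n C suc k) * x ^ℚ (n ℕ.∸ k)
    ≡⟨ cong (_* x ^ℚ (n ℕ.∸ k)) (ℕ→ℚ-+ (n C k) (n C suc k)) ⟩
  (ℕ→ℚ (n C k) + ℕ→ℚ (n C suc k)) * x ^ℚ (n ℕ.∸ k)
    ≡⟨ *-distribʳ-+ (x ^ℚ (n ℕ.∸ k)) (ℕ→ℚ (n C k)) (ℕ→ℚ (n C suc k)) ⟩
  binomialTerm n x k + ℕ→ℚ (n C suc k) * x ^ℚ (n ℕ.∸ k)
    ≡⟨ cong (_+_ (binomialTerm n x k)) (nC[1+k]*x^[n∸k]≡x*binomialTerm n k x) ⟩
  binomialTerm n x k + x * binomialTerm n x (suc k)
    ≡⟨ +-comm (binomialTerm n x k) (x * binomialTerm n x (suc k)) ⟩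
  x * binomialTerm n x (suc k) + binomialTerm n x k
    ∎
  where open ≡-Reasoning

-- Bpoly n p x is definitionally appell (λ k → B k p) n x.
appell : (ℕ → ℚ) → ℕ → ℚ → ℚ
appell a n x = Σ≤ n (λ k → binomialTerm n x k * a k)

appell-suc : ∀ a n x → appell a (suc n) x ≡ x * appell a n x + appell (a ∘ suc) n x
appell-suc a n x = begin
  appell a (suc n) x
    ≡⟨ Σ≤-shift n (λ k → binomialTerm (suc n) x k * a k) ⟩
  binomialTerm (suc n) x 0 * a 0 + Σ≤ n (λ j → binomialTerm (suc n) x (suc j) * a (suc j))
    ≡⟨ cong₂ _+_ (cong (_* a 0) (binomialTerm-suc-zero n x)) (Σ≤-cong n pascal) ⟩
  x * binomialTerm n x 0 * a 0 + Σ≤ n (λ j → x * term (suc j) + binomialTerm n x j * a (suc j))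
    ≡⟨ cong (_+_ (x * binomialTerm n x 0 * a 0)) (Σ≤-distrib-+ n (λ j → x * term (suc j)) _) ⟩
  x * binomialTerm n x 0 * a 0 + (Σ≤ n (λ j → x * term (suc j)) + appell (a ∘ suc) n x)
    ≡⟨ +-assoc (x * binomialTerm n x 0 * a 0) (Σ≤ n (λ j → x * term (suc j))) (appell (a ∘ suc) n x) ⟨
  x * binomialTerm n x 0 * a 0 + Σ≤ n (λ j → x * term (suc j)) + appell (a ∘ suc) n x
    ≡⟨ cong (_+ appell (a ∘ suc) n x) x*appell ⟩
  x * appell a n x + appell (a ∘ suc) n x
    ∎
  where
  open ≡-Reasoning
  term : ℕ → ℚ
  term k = binomialTerm n x k * a k

  pascal : ∀ j → binomialTerm (suc n) x (suc j) * a (suc j)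
                 ≡ x * term (suc j) + binomialTerm n x j * a (suc j)
  pascal j = trans (cong (_* a (suc j)) (binomialTerm-suc-suc n x j))
    (trans (*-distribʳ-+ (a (suc j)) (x * binomialTerm n x (suc j)) (binomialTerm n x j))
           (cong (_+ binomialTerm n x j * a (suc j)) (*-assoc x (binomialTerm n x (suc j)) (a (suc j)))))

  term[1+n]≡0 : term (suc n) ≡ 0ℚ
  term[1+n]≡0 = trans (cong (_* a (suc n)) (k>n⇒binomialTerm≡0 x (ℕ.n<1+n n))) (*-zeroˡ (a (suc n)))

  x*appell : x * binomialTerm n x 0 * a 0 + Σ≤ n (λ j → x * term (suc j)) ≡ x * appell a n x
  x*appell = begin
    x * binomialTerm n x 0 * a 0 + Σ≤ n (λ j → x * term (suc j))
      ≡⟨ cong₂ _+_ (*-assoc x (binomialTerm n x 0) (a 0)) (sym (*-distribˡ-Σ≤ n x (term ∘ suc))) ⟩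
    x * term 0 + x * Σ≤ n (term ∘ suc)  ≡⟨ *-distribˡ-+ x (term 0) (Σ≤ n (term ∘ suc)) ⟨
    x * (term 0 + Σ≤ n (term ∘ suc))    ≡⟨ cong (x *_) (Σ≤-shift-vanishing n term term[1+n]≡0) ⟩
    x * appell a n x                    ∎

appell-linear : ∀ u v a b n x →
  appell (λ k → u * a k - v * b k) n x ≡ u * appell a n x - v * appell b n x
appell-linear u v a b n x = begin
  Σ≤ n (λ k → binomialTerm n x k * (u * a k - v * b k))
    ≡⟨ Σ≤-cong n (λ k → distribute (binomialTerm n x k) u (a k) v (b k)) ⟩
  Σ≤ n (λ k → u * (binomialTerm n x k * a k) + (- v) * (binomialTerm n x k * b k))
    ≡⟨ Σ≤-distrib-+ n _ _ ⟩
  Σ≤ n (λ k → u * (binomialTerm n x k * a k)) + Σ≤ n (λ k → (- v) * (binomialTerm n x k * b k))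
    ≡⟨ cong₂ _+_ (*-distribˡ-Σ≤ n u _) (*-distribˡ-Σ≤ n (- v) _) ⟨
  u * appell a n x + (- v) * appell b n x
    ≡⟨ cong (_+_ (u * appell a n x)) (neg-distribˡ-* v (appell b n x)) ⟨
  u * appell a n x - v * appell b n x
    ∎
  where
  open ≡-Reasoning
  distribute : ∀ w u a v b → w * (u * a - v * b) ≡ u * (w * a) + (- v) * (w * b)
  distribute = solve-∀ ℚ-ring

Bpoly-suc : ∀ n p x → Bpoly (suc n) p x ≡ (x + ℕ→ℚ p) * Bpoly n p x - κ p * Bpoly n (suc p) x
Bpoly-suc n p x = begin
  Bpoly (suc n) p x
    ≡⟨ appell-suc (λ k → B k p) n x ⟩
  x * Bpoly n p x + appell (λ k → B (suc k) p) n x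
    ≡⟨ cong (_+_ (x * Bpoly n p x))
            (appell-linear (ℕ→ℚ p) (κ p) (λ k → B k p) (λ k → B k (suc p)) n x) ⟩
  x * Bpoly n p x + (ℕ→ℚ p * Bpoly n p x - κ p * Bpoly n (suc p) x)
    ≡⟨ +-assoc (x * Bpoly n p x) (ℕ→ℚ p * Bpoly n p x) (- (κ p * Bpoly n (suc p) x)) ⟨
  x * Bpoly n p x + ℕ→ℚ p * Bpoly n p x - κ p * Bpoly n (suc p) x
    ≡⟨ cong (_- κ p * Bpoly n (suc p) x) (*-distribʳ-+ (Bpoly n p x) x (ℕ→ℚ p)) ⟨
  (x + ℕ→ℚ p) * Bpoly n p x - κ p * Bpoly n (suc p) x
    ∎
  where open ≡-Reasoning

difference-of-recurrence : ∀ x s c P P′ Q Q′ →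
  ((x + 1ℚ) + s) * P - c * Q - ((x + s) * P′ - c * Q′) ≡ (x + s) * (P - P′) + P - c * (Q - Q′)
difference-of-recurrence = solve-∀ ℚ-ring

collect-factor : ∀ x s r c A P X → r * s ≡ 1ℚ + s → c * r ≡ s →
  (x + s) * (r * (A - X)) + P - (1ℚ + s) * (P - X) ≡ r * ((x + s) * A - c * P - x * X)
collect-factor x s r c A P X rs≡1+s cr≡s = begin
  (x + s) * (r * (A - X)) + P - (1ℚ + s) * (P - X)
    ≡⟨ solve (x ∷ s ∷ r ∷ c ∷ A ∷ P ∷ X ∷ []) ℚ-ring ⟩
  r * ((x + s) * A - x * X) + (1ℚ + s - r * s) * X - s * P
    ≡⟨ cong₂ (λ a b → r * ((x + s) * A - x * X) + (1ℚ + s - a) * X - b * P) rs≡1+s (sym cr≡s) ⟩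
  r * ((x + s) * A - x * X) + (1ℚ + s - (1ℚ + s)) * X - c * r * P
    ≡⟨ solve (x ∷ s ∷ r ∷ c ∷ A ∷ P ∷ X ∷ []) ℚ-ring ⟩
  r * ((x + s) * A - c * P - x * X)
    ∎
  where open ≡-Reasoning

DifferenceLaw : ℕ → ℕ → ℚ → Set
DifferenceLaw n p x =
  Bpoly n (suc p) (x + 1ℚ) - Bpoly n (suc p) x ≡ ρ p * (Bpoly n p (x + 1ℚ) - x ^ℚ n)

differenceLaw-suc : ∀ n p x →
  DifferenceLaw n p x → DifferenceLaw n (suc p) x → DifferenceLaw (suc n) p x
differenceLaw-suc n p x Δ₀ Δ₁ = begin
  Bpoly (suc n) (suc p) (x + 1ℚ) - Bpoly (suc n) (suc p) x
    ≡⟨ cong₂ _-_ (Bpoly-suc n (suc p) (x + 1ℚ)) (Bpoly-suc n (suc p) x) ⟩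
  ((x + 1ℚ) + s) * P - κ (suc p) * Q - ((x + s) * P′ - κ (suc p) * Q′)
    ≡⟨ difference-of-recurrence x s (κ (suc p)) P P′ Q Q′ ⟩
  (x + s) * (P - P′) + P - κ (suc p) * (Q - Q′)
    ≡⟨ cong₂ (λ d e → (x + s) * d + P - κ (suc p) * e) Δ₀ Δ₁ ⟩
  (x + s) * (ρ p * (A - X)) + P - κ (suc p) * (ρ (suc p) * (P - X))
    ≡⟨ cong (λ c → (x + s) * (ρ p * (A - X)) + P - c) κ′ρ′[P-X] ⟩
  (x + s) * (ρ p * (A - X)) + P - (1ℚ + s) * (P - X)
    ≡⟨ collect-factor x s (ρ p) (κ p) A P X
         (trans (ρ*[1+p]≡2+p p) (ℕ→ℚ-suc (suc p))) (κ*ρ≡1+p p) ⟩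
  ρ p * ((x + s) * A - κ p * P - x * X)
    ≡⟨ cong (λ y → ρ p * (y * A - κ p * P - x * X)) x+s≡[x+1]+p ⟩
  ρ p * (((x + 1ℚ) + ℕ→ℚ p) * A - κ p * P - x * X)
    ≡⟨ cong (λ b → ρ p * (b - x * X)) (Bpoly-suc n p (x + 1ℚ)) ⟨
  ρ p * (Bpoly (suc n) p (x + 1ℚ) - x ^ℚ suc n)
    ∎
  where
  open ≡-Reasoning
  s A P P′ Q Q′ X : ℚ
  s  = ℕ→ℚ (suc p)
  A  = Bpoly n p (x + 1ℚ)
  P  = Bpoly n (suc p) (x + 1ℚ)
  P′ = Bpoly n (suc p) x
  Q  = Bpoly n (suc (suc p)) (x + 1ℚ)
  Q′ = Bpoly n (suc (suc p)) x
  X  = x ^ℚ n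

  κ′ρ′[P-X] : κ (suc p) * (ρ (suc p) * (P - X)) ≡ (1ℚ + s) * (P - X)
  κ′ρ′[P-X] = trans (sym (*-assoc (κ (suc p)) (ρ (suc p)) (P - X)))
                    (cong (_* (P - X)) (trans (κ*ρ≡1+p (suc p)) (ℕ→ℚ-suc (suc p))))

  x+s≡[x+1]+p : x + s ≡ (x + 1ℚ) + ℕ→ℚ p
  x+s≡[x+1]+p = trans (cong (_+_ x) (ℕ→ℚ-suc p)) (sym (+-assoc x 1ℚ (ℕ→ℚ p)))

proposition2 : (n p : ℕ) (x : ℚ) →
    Bpoly n (suc p) (x + 1ℚ) - Bpoly n (suc p) x
      ≡ ((+ suc (suc p)) / suc p) * (Bpoly n p (x + 1ℚ) - x ^ℚ n)
proposition2 zero    p x = sym (*-zeroʳ (ρ p))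
proposition2 (suc n) p x = differenceLaw-suc n p x (proposition2 n p x) (proposition2 n (suc p) x)
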